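{- Let $\mathbf{q}\in\mathbb{PE}[\mathbf{x}]^d$ be a closed form of an nnt-loop $\textbf{while } \phi \textbf{ do } \mathbf{x}\leftarrow A\mathbf{x}+\mathbf{a}$ (i.e., $\mathbf{q}[n/c]=f^c(\mathbf{x})$ for all $c\in\mathbb{N}$, where $f(\mathbf{x})=A\mathbf{x}+\mathbf{a}$). Let $\mathbf{q}_{norm}$ result from $\mathbf{q}$ by removing all addends $[\![\psi]\!]\cdot\alpha\cdot n^a\cdot b^n$ where $\psi$ contains a positive literal (a literal of the form $n=c$), and by replacing every addend $[\![\psi]\!]\cdot\alpha\cdot n^a\cdot b^n$ where $\psi$ contains no positive literal by $\alpha\cdot n^a\cdot b^n$. Then $\mathbf{c}\in\mathbb{Z}^d$ is a witness for eventual non-termination if and only if $\exists n_0\in\mathbb{N}.\ \forall n\in\mathbb{N}_{>n_0}.\ \phi[\mathbf{x}/\mathbf{q}_{norm}][\mathbf{x}/\mathbf{c}]$.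
   Context: An nnt-loop is $\textbf{while } \phi \textbf{ do } \mathbf{x}\leftarrow A\mathbf{x}+\mathbf{a}$ with $A\in\mathbb{Z}^{d\times d}$ triangular (upper or lower) with non-negative diagonal, $\mathbf{a}\in\mathbb{Z}^d$, $\mathbf{x}=(x_1,\dots,x_d)$ pairwise different variables, and $\phi$ a conjunction of inequalities $\alpha>0$ with $\alpha$ affine with rational coefficients over $\mathbf{x}$. A vector $\mathbf{c}\in\mathbb{Z}^d$ witnesses eventual non-termination if $\exists n_0\in\mathbb{N}.\ \forall n\in\mathbb{N}_{>n_0}.\ \phi[\mathbf{x}/f^n(\mathbf{c})]$. $n$ is a designated variable over $\mathbb{N}$; $\mathbb{PE}[\mathbf{x}]$ is the set of expressions $\sum_{j=1}^{\ell}[\![\psi_j]\!]\cdot\alpha_j\cdot n^{a_j}\cdot b_j^n$ with $\ell,a_j\in\mathbb{N}$, $\psi_j$ a finite conjunction of literals $n=c$, $n\ne c$ ($c\in\mathbb{N}$), $[\![\psi_j]\!]$ its characteristic function, $\alpha_j$ affine over $\mathbf{x}$ with rational coefficients, $b_j\in\mathbb{N}_{\ge1}$. -}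

module Defs where

open import Data.Nat as ℕ using (ℕ; zero; suc)
open import Data.Integer as ℤ using (ℤ; +_)
open import Data.Rational as ℚ using (ℚ; 0ℚ; 1ℚ)
import Data.Fin
open import Data.Fin using (Fin; toℕ)
open import Data.List using (List; []; _∷_; foldr)
open import Data.Bool.ListAction using (any)
open import Data.List.Relation.Unary.All using (All)
open import Data.Bool using (Bool; true; false; not; _∧_)
open import Data.Sum using (_⊎_)
open import Relation.Nullary using (Dec; yes; no)
open import Relation.Nullary.Decidable using (⌊_⌋)
open import Relation.Binary.PropositionalEquality using (_≡_)
open import Data.Product using (∃-syntax; _×_)

ℤtoℚ : ℤ → ℚ
ℤtoℚ z = z ℚ./ 1

ℕtoℚ : ℕ → ℚ
ℕtoℚ k = (+ k) ℚ./ 1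

sumFin : (d : ℕ) → (Fin d → ℚ) → ℚ
sumFin zero    f = 0ℚ
sumFin (suc d) f = f Data.Fin.zero ℚ.+ sumFin d (λ i → f (Data.Fin.suc i))

sumℤ : (d : ℕ) → (Fin d → ℤ) → ℤ
sumℤ zero    f = + 0
sumℤ (suc d) f = f Data.Fin.zero ℤ.+ sumℤ d (λ i → f (Data.Fin.suc i))

record Affine (d : ℕ) : Set where
  constructor affine
  field
    coeff : Fin d → ℚ
    const : ℚ
open Affine public

evalAff : ∀ {d} → Affine d → (Fin d → ℚ) → ℚ
evalAff {d} α v = sumFin d (λ i → coeff α i ℚ.* v i) ℚ.+ const α

Guard : ℕ → Set
Guard d = List (Affine d)

holds : ∀ {d} → Guard d → (Fin d → ℚ) → Set
holds φ v = All (λ α → 0ℚ ℚ.< evalAff α v) φ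

Matrix : ℕ → Set
Matrix d = Fin d → Fin d → ℤ

UpperTriangular : ∀ {d} → Matrix d → Set
UpperTriangular {d} A = ∀ (i j : Fin d) → toℕ j ℕ.< toℕ i → A i j ≡ + 0

LowerTriangular : ∀ {d} → Matrix d → Set
LowerTriangular {d} A = ∀ (i j : Fin d) → toℕ i ℕ.< toℕ j → A i j ≡ + 0

Triangular : ∀ {d} → Matrix d → Set
Triangular A = UpperTriangular A ⊎ LowerTriangular A

NonNegDiagonal : ∀ {d} → Matrix d → Set
NonNegDiagonal {d} A = ∀ (i : Fin d) → + 0 ℤ.≤ A i i

record NNTLoop (d : ℕ) : Set where
  constructor loop
  field
    guard  : Guard d
    A      : Matrix d
    a      : Fin d → ℤ
    triang : Triangular A
    nonneg : NonNegDiagonal A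
open NNTLoop public

update : ∀ {d} → NNTLoop d → (Fin d → ℤ) → (Fin d → ℤ)
update {d} L x i = sumℤ d (λ j → A L i j ℤ.* x j) ℤ.+ a L i

iter : ∀ {d} → NNTLoop d → ℕ → (Fin d → ℤ) → (Fin d → ℤ)
iter L zero    x = x
iter L (suc n) x = update L (iter L n x)

toℚvec : ∀ {d} → (Fin d → ℤ) → (Fin d → ℚ)
toℚvec x i = ℤtoℚ (x i)

WitnessENT : ∀ {d} → NNTLoop d → (Fin d → ℤ) → Set
WitnessENT L c =
  ∃[ n₀ ] (∀ (n : ℕ) → n₀ ℕ.< n → holds (guard L) (toℚvec (iter L n c)))

-- Poly-exponential expressions PE[x]:
-- Σ_j [[ψ_j]] · α_j · n^{a_j} · b_j^n

data Literal : Set where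
  eqLit  : ℕ → Literal
  neqLit : ℕ → Literal

Cond : Set
Cond = List Literal

litVal : Literal → ℕ → Bool
litVal (eqLit c)  n = ⌊ n ℕ.≟ c ⌋
litVal (neqLit c) n = not ⌊ n ℕ.≟ c ⌋

charFun : Cond → ℕ → ℚ
charFun ψ n with foldr (λ l r → litVal l n ∧ r) true ψ
... | true  = 1ℚ
... | false = 0ℚ

record Addend (d : ℕ) : Set where
  constructor addend
  field
    cond   : Cond
    alpha  : Affine d
    expo   : ℕ
    base   : ℕ
    base≥1 : 1 ℕ.≤ base
open Addend public

PE : ℕ → Set
PE d = List (Addend d)

evalAddend : ∀ {d} → Addend d → ℕ → (Fin d → ℚ) → ℚ
evalAddend t n v =
  charFun (cond t) n ℚ.* evalAff (alpha t) v
    ℚ.* ℕtoℚ (n ℕ.^ expo t) ℚ.* ℕtoℚ (base t ℕ.^ n)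

evalPE : ∀ {d} → PE d → ℕ → (Fin d → ℚ) → ℚ
evalPE q n v = foldr (λ t r → evalAddend t n v ℚ.+ r) 0ℚ q

-- q ∈ PE[x]^d is a closed form of the loop: q[n/c] = f^c(x) for all c ∈ ℕ
-- (as an identity in x, i.e. for all integer vectors x)
IsClosedForm : ∀ {d} → NNTLoop d → (Fin d → PE d) → Set
IsClosedForm {d} L q =
  ∀ (c : ℕ) (x : Fin d → ℤ) (i : Fin d) →
    evalPE (q i) c (toℚvec x) ≡ ℤtoℚ (iter L c x i)

isPosLit : Literal → Bool
isPosLit (eqLit _)  = true
isPosLit (neqLit _) = false

hasPosLit : Cond → Bool
hasPosLit ψ = any isPosLit ψ

-- drop addends whose ψ contains a positive literal; replace [[ψ]]·α·n^a·b^n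
-- by α·n^a·b^n otherwise (ψ := empty conjunction, whose char. function is 1)
normAddends : ∀ {d} → PE d → PE d
normAddends [] = []
normAddends (t ∷ ts) with hasPosLit (cond t)
... | true  = normAddends ts
... | false = addend [] (alpha t) (expo t) (base t) (base≥1 t) ∷ normAddends ts

qnorm : ∀ {d} → (Fin d → PE d) → (Fin d → PE d)
qnorm q i = normAddends (q i)

guardAtNorm : ∀ {d} → NNTLoop d → (Fin d → PE d) → (Fin d → ℤ) → ℕ → Set
guardAtNorm L q c n = holds (guard L) (λ i → evalPE (qnorm q i) n (toℚvec c))

module Submission where

-- A characteristic function [[ψ]] is only "interesting"
-- at the finitely many points n mentioned by the literals of ψ: once n exceeds
-- every constant c occurring in ψ, each literal n = c is false and each literal
-- n ≠ c is true, so [[ψ]](n) is 0 if ψ has a positive literal and 1 otherwise.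
-- Hence beyond a bound N computed from the constants in q, the expressions
-- q and q_norm take the same value at every point, and since q is a closed
-- form, f^n(c) equals q_norm evaluated at time n and point c for all n > N.  The guard φ therefore holds
-- at f^n(c) exactly when it holds at q_norm(n)(c), for all n > N, and two
-- predicates on ℕ that agree beyond some N are eventually true together.

open import Defs
open import Data.Nat using (ℕ; _<_)
open import Data.Integer using (ℤ)
open import Data.Fin using (Fin)
open import Data.Product using (∃-syntax)
open import Function.Bundles using (_⇔_)

open import Data.Nat as ℕ using (zero; suc; _⊔_)
open import Data.Nat.Properties using (m⊔n<o⇒m<o; m⊔n<o⇒n<o; <⇒≢)
import Data.Fin as Fin
open import Data.Rational as ℚ using (ℚ; 0ℚ; 1ℚ)
open import Data.Rational.Properties using (*-zeroˡ; +-identityˡ)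
open import Data.List using ([]; _∷_; foldr)
open import Data.List.Relation.Unary.All as All using ()
open import Data.Bool using (Bool; true; false; not; _∧_; if_then_else_)
open import Data.Product using (_,_)
open import Relation.Nullary using (yes; no; contradiction)
open import Relation.Nullary.Decidable using (⌊_⌋)
open import Relation.Binary.PropositionalEquality
  using (_≡_; refl; sym; trans; cong; cong₂; subst; module ≡-Reasoning)
open import Function.Bundles using (mk⇔)

Eventually : (ℕ → Set) → Set
Eventually P = ∃[ n₀ ] (∀ (n : ℕ) → n₀ < n → P n)

eventually-transfer : ∀ {P Q : ℕ → Set} (N : ℕ) →
  (∀ n → N < n → P n → Q n) → Eventually P → Eventually Q
eventually-transfer N P⇒Q (n₀ , P-eventually) =
  n₀ ⊔ N , λ n lt → P⇒Q n (m⊔n<o⇒n<o _ _ lt) (P-eventually n (m⊔n<o⇒m<o _ _ lt))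

eventually-agree : ∀ {P Q : ℕ → Set} (N : ℕ) →
  (∀ n → N < n → P n → Q n) → (∀ n → N < n → Q n → P n) →
  Eventually P ⇔ Eventually Q
eventually-agree N P⇒Q Q⇒P =
  mk⇔ (eventually-transfer N P⇒Q) (eventually-transfer N Q⇒P)

literalBound : Literal → ℕ
literalBound (eqLit c)  = c
literalBound (neqLit c) = c

condBound : Cond → ℕ
condBound []      = 0
condBound (l ∷ ψ) = literalBound l ⊔ condBound ψ

peBound : ∀ {d} → PE d → ℕ
peBound []       = 0
peBound (t ∷ ts) = condBound (cond t) ⊔ peBound ts

vecBound : ∀ {e} (d : ℕ) → (Fin d → PE e) → ℕ
vecBound zero    q = 0
vecBound (suc d) q = peBound (q Fin.zero) ⊔ vecBound d (λ i → q (Fin.suc i))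

vecBound-component : ∀ {e} d (q : Fin d → PE e) {n} → vecBound d q < n →
  ∀ i → peBound (q i) < n
vecBound-component (suc d) q lt Fin.zero    = m⊔n<o⇒m<o _ _ lt
vecBound-component (suc d) q lt (Fin.suc i) =
  vecBound-component d (λ i → q (Fin.suc i)) (m⊔n<o⇒n<o _ _ lt) i

≟-beyond : ∀ n c → c < n → ⌊ n ℕ.≟ c ⌋ ≡ false
≟-beyond n c lt with n ℕ.≟ c
... | yes n≡c = contradiction (sym n≡c) (<⇒≢ lt)
... | no  _   = refl

condValue : Cond → ℕ → Bool
condValue ψ n = foldr (λ l r → litVal l n ∧ r) true ψ

condValue-beyond : ∀ ψ {n} → condBound ψ < n → condValue ψ n ≡ not (hasPosLit ψ)
condValue-beyond []             lt = refl
condValue-beyond (eqLit c  ∷ ψ) {n} lt rewrite ≟-beyond n c (m⊔n<o⇒m<o _ _ lt) = refl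
condValue-beyond (neqLit c ∷ ψ) {n} lt rewrite ≟-beyond n c (m⊔n<o⇒m<o _ _ lt) =
  condValue-beyond ψ (m⊔n<o⇒n<o _ _ lt)

charFun-beyond : ∀ ψ {n} → condBound ψ < n →
  charFun ψ n ≡ (if hasPosLit ψ then 0ℚ else 1ℚ)
charFun-beyond ψ {n} lt with condValue ψ n | condValue-beyond ψ lt
charFun-beyond ψ lt | _ | refl with hasPosLit ψ
... | true  = refl
... | false = refl

addend-vanishes : ∀ {d} (t : Addend d) {n} v → charFun (cond t) n ≡ 0ℚ →
  evalAddend t n v ≡ 0ℚ
addend-vanishes t {n} v χ≡0 = begin
  charFun (cond t) n ℚ.* α ℚ.* nᵃ ℚ.* bⁿ  ≡⟨ cong (λ χ → χ ℚ.* α ℚ.* nᵃ ℚ.* bⁿ) χ≡0 ⟩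
  0ℚ ℚ.* α ℚ.* nᵃ ℚ.* bⁿ                 ≡⟨ cong (λ z → z ℚ.* nᵃ ℚ.* bⁿ) (*-zeroˡ α) ⟩
  0ℚ ℚ.* nᵃ ℚ.* bⁿ                       ≡⟨ cong (ℚ._* bⁿ) (*-zeroˡ nᵃ) ⟩
  0ℚ ℚ.* bⁿ                              ≡⟨ *-zeroˡ bⁿ ⟩
  0ℚ                                     ∎
  where
  open ≡-Reasoning
  α  = evalAff (alpha t) v
  nᵃ = ℕtoℚ (n ℕ.^ expo t)
  bⁿ = ℕtoℚ (base t ℕ.^ n)

addend-unconditional : ∀ {d} (t : Addend d) {n} v → charFun (cond t) n ≡ 1ℚ →
  evalAddend t n v ≡ evalAddend (addend [] (alpha t) (expo t) (base t) (base≥1 t)) n v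
addend-unconditional t {n} v χ≡1 =
  cong (λ χ → χ ℚ.* evalAff (alpha t) v ℚ.* ℕtoℚ (n ℕ.^ expo t) ℚ.* ℕtoℚ (base t ℕ.^ n)) χ≡1

normAddends-beyond : ∀ {d} (q : PE d) {n} v → peBound q < n →
  evalPE q n v ≡ evalPE (normAddends q) n v
normAddends-beyond []       v lt = refl
normAddends-beyond (t ∷ ts) {n} v lt
  with hasPosLit (cond t) | charFun-beyond (cond t) (m⊔n<o⇒m<o _ _ lt)
... | true  | χ≡0 = begin
  evalAddend t n v ℚ.+ evalPE ts n v  ≡⟨ cong (ℚ._+ evalPE ts n v) (addend-vanishes t v χ≡0) ⟩
  0ℚ ℚ.+ evalPE ts n v                ≡⟨ +-identityˡ _ ⟩
  evalPE ts n v                       ≡⟨ normAddends-beyond ts v (m⊔n<o⇒n<o _ _ lt) ⟩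
  evalPE (normAddends ts) n v         ∎
  where open ≡-Reasoning
... | false | χ≡1 =
  cong₂ ℚ._+_ (addend-unconditional t v χ≡1) (normAddends-beyond ts v (m⊔n<o⇒n<o _ _ lt))

iter-qnorm : ∀ {d} (L : NNTLoop d) (q : Fin d → PE d) → IsClosedForm L q →
  ∀ c {n} → vecBound d q < n →
  ∀ i → toℚvec (iter L n c) i ≡ evalPE (qnorm q i) n (toℚvec c)
iter-qnorm {d} L q closed c {n} lt i =
  trans (sym (closed n c i)) (normAddends-beyond (q i) (toℚvec c) (vecBound-component d q lt i))

sumFin-cong : ∀ d {f g : Fin d → ℚ} → (∀ i → f i ≡ g i) → sumFin d f ≡ sumFin d g
sumFin-cong zero    f≗g = refl
sumFin-cong (suc d) f≗g = cong₂ ℚ._+_ (f≗g Fin.zero) (sumFin-cong d (λ i → f≗g (Fin.suc i)))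

holds-cong : ∀ {d} (φ : Guard d) {v w : Fin d → ℚ} → (∀ i → v i ≡ w i) →
  holds φ v → holds φ w
holds-cong φ v≗w = All.map λ {α} → subst (0ℚ ℚ.<_)
  (cong (ℚ._+ const α) (sumFin-cong _ (λ i → cong (coeff α i ℚ.*_) (v≗w i))))

corollary3 : ∀ {d : ℕ} (L : NNTLoop d) (q : Fin d → PE d) → IsClosedForm L q → (c : Fin d → ℤ) → WitnessENT L c ⇔ (∃[ n₀ ] (∀ (n : ℕ) → n₀ < n → guardAtNorm L q c n))
corollary3 {d} L q closed c = eventually-agree (vecBound d q)
  (λ n lt → holds-cong (guard L) (iter-qnorm L q closed c lt))
  (λ n lt → holds-cong (guard L) (λ i → sym (iter-qnorm L q closed c lt i)))
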